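{- Let $N=(P,T,F)$ be a safe and sound WF-net and $G=\{T_{do},T_{redo},T_\tau\}$ such that $(N,G)$ is a loop pattern with places $p_{do},p_{redo}$. Let $N_{do}=\mathrm{loopproject}(N,T_{do})$ and $N_{redo}=\mathrm{loopproject}(N,T_{redo})$. Then $N_{do}$ and $N_{redo}$ are safe and sound WF-nets.
   Context: A Petri net is a triple $N=(P,T,F)$ with finite disjoint sets $P$ (places) and $T$ (transitions) and flow relation $F\subseteq(P\times T)\cup(T\times P)$; each transition has a label in $\mathcal{A}\cup\{\tau\}$ ($\tau$ the silent label). For a node $x$, ${}^\bullet x=\{y\mid (y,x)\in F\}$ and $x^\bullet=\{y\mid (x,y)\in F\}$. A marking is a multiset of places; $t$ is enabled if every place of ${}^\bullet t$ holds a token, and firing it removes one token from each place of ${}^\bullet t$ and adds one to each place of $t^\bullet$. $N$ is a WF-net if there are places $i_N$, $o_N$ with $\{p\mid {}^\bullet p=\emptyset\}=\{i_N\}$, $\{p\mid p^\bullet=\emptyset\}=\{o_N\}$, and every node lies on a directed path from $i_N$ to $o_N$. A WF-net is safe if no marking reachable from $[i_N]$ has a place with more than one token; it is sound if (i) every transition is enabled in some marking reachable from $[i_N]$, (ii) from every marking reachable from $[i_N]$ the marking $[o_N]$ is reachable, and (iii) $[o_N]$ is the only reachable marking with a token in $o_N$. For $T'\subseteq T$, $P|_{T'}=\{p\in P\mid({}^\bullet p\cup p^\bullet)\cap T'\ne\emptyset\}$ and, for $P'\subseteq P$, $F|_{P',T'}=F\cap((P'\times T')\cup(T'\times P'))$.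 For places $p,p'$, $\mathrm{PTR}(p,p')$ is the set of transitions $t$ for which there exist $t_1,\dots,t_n\in T$ and $p_1=p,\dots,p_{n+1}=p'$ in $P$ with $t\in\{t_1,\dots,t_n\}$ and, for each $k\le n$, $p_k\neq p'$, $(p_k,t_k)\in F$, $(t_k,p_{k+1})\in F$. Loop pattern: for a safe and sound WF-net $N$ and a partition $G=\{T_{do},T_{redo},T_\tau\}$ of $T$ of size 3, $(N,G)$ is a loop pattern iff there exist places $p_{do},p_{redo}$ with: (1) $T_\tau=\{t_{source},t_{sink}\}$, $t_{source}\neq t_{sink}$, both labelled $\tau$; (2) $i_N^\bullet=\{t_{source}\}$, ${}^\bullet o_N=\{t_{sink}\}$; (3) ${}^\bullet t_{source}=\{i_N\}$, $t_{source}^\bullet=\{p_{do}\}$; (4) ${}^\bullet t_{sink}=\{p_{redo}\}$, $t_{sink}^\bullet=\{o_N\}$; (5) $T_{do}=\mathrm{PTR}(p_{do},p_{redo})$ and $T_{redo}=\mathrm{PTR}(p_{redo},p_{do})$; (6) ${}^\bullet p_{do}\cap T_{do}=\emptyset$, ${}^\bullet p_{redo}\cap T_{redo}=\emptyset$; (7) $p_{redo}^\bullet\cap T_{do}=\emptyset$, $p_{do}^\bullet\cap T_{redo}=\emptyset$. Loop projection: for $T'\in\{T_{do},T_{redo}\}$, let $(p_{start},p_{end})=(p_{do},p_{redo})$ if $T'=T_{do}$ and $(p_{redo},p_{do})$ if $T'=T_{redo}$; then $\mathrm{loopproject}(N,T')=(P',T',F')$ where $P'=(P|_{T'}\setminus\{p_{do},p_{redo}\})\cup\{i_N,o_N\}$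 and $F'=F|_{P',T'}\cup\{(i_N,t)\mid t\in T',(p_{start},t)\in F\}\cup\{(t,o_N)\mid t\in T',(t,p_{end})\in F\}$. -}

module Defs where

open import Data.Nat using (ℕ; zero; suc; _+_; _∸_; _≤_)
open import Data.Fin using (Fin; zero; suc; _≟_)
open import Data.Bool using (Bool; true; false; T; _∧_; _∨_; not; if_then_else_)
open import Data.Maybe using (Maybe; nothing)
open import Data.List using (List; []; _∷_)
open import Data.List.Membership.Propositional using (_∈_)
open import Data.Product using (Σ; ∃; _×_; _,_)
open import Data.Sum using (_⊎_)
open import Data.Empty using (⊥)
open import Relation.Nullary using (¬_)
open import Relation.Nullary.Decidable using (⌊_⌋)
open import Relation.Binary.PropositionalEquality using (_≡_; _≢_)
open import Relation.Binary.Construct.Closure.ReflexiveTransitive using (Star)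
open import Function.Bundles using (_⇔_)

-- Places are drawn from the ambient finite type Fin np and
-- transitions from Fin nt (so P and T are automatically finite and
-- disjoint); the net itself selects its place set P and transition set T
-- as Boolean subsets.  The flow relation F is given by its two halves
-- pre p t  <->  (p,t) ∈ F   and   post t p  <->  (t,p) ∈ F.
-- Labels live in Maybe A, where `nothing` is the silent label τ.

record Net (A : Set) (np nt : ℕ) : Set where
  field
    place : Fin np → Bool
    trans : Fin nt → Bool
    pre   : Fin np → Fin nt → Bool
    post  : Fin nt → Fin np → Bool
    label : Fin nt → Maybe A

open Net public

module _ {A : Set} {np nt : ℕ} (N : Net A np nt) where

  FlowWellFormed : Set
  FlowWellFormed =
    (∀ p t → T (pre N p t) → T (place N p) × T (trans N t)) ×
    (∀ t p → T (post N t p) → T (trans N t) × T (place N p))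

  data Node : Set where
    pl : Fin np → Node
    tr : Fin nt → Node

  data Edge : Node → Node → Set where
    pt : ∀ {p t} → T (pre N p t) → Edge (pl p) (tr t)
    tp : ∀ {t p} → T (post N t p) → Edge (tr t) (pl p)

  Path : Node → Node → Set
  Path = Star Edge

  IsWFNet : Fin np → Fin np → Set
  IsWFNet i o =
    FlowWellFormed ×
    (T (place N i) × (∀ t → ¬ T (post N t i)) ×
       (∀ p → T (place N p) → (∀ t → ¬ T (post N t p)) → p ≡ i)) ×
    (T (place N o) × (∀ t → ¬ T (pre N o t)) ×
       (∀ p → T (place N p) → (∀ t → ¬ T (pre N p t)) → p ≡ o)) ×
    (∀ p → T (place N p) → Path (pl i) (pl p) × Path (pl p) (pl o)) ×
    (∀ t → T (trans N t) → Path (pl i) (tr t) × Path (tr t) (pl o))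

  Marking : Set
  Marking = Fin np → ℕ

  [_] : Fin np → Marking
  [ p ] q = if ⌊ q ≟ p ⌋ then 1 else 0

  _≐_ : Marking → Marking → Set
  m ≐ m' = ∀ p → m p ≡ m' p

  b2n : Bool → ℕ
  b2n b = if b then 1 else 0

  Enabled : Marking → Fin nt → Set
  Enabled m t = T (trans N t) × (∀ p → T (pre N p t) → 1 ≤ m p)

  fire : Marking → Fin nt → Marking
  fire m t p = (m p ∸ b2n (pre N p t)) + b2n (post N t p)

  Step : Marking → Marking → Set
  Step m m' = Σ (Fin nt) λ t → Enabled m t × (m' ≐ fire m t)

  Reach : Marking → Marking → Set
  Reach = Star Step

  Safe : Fin np → Set
  Safe i = ∀ m → Reach [ i ] m → ∀ p → m p ≤ 1

  Sound : Fin np → Fin np → Set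
  Sound i o =
    (∀ t → T (trans N t) → Σ Marking λ m → Reach [ i ] m × Enabled m t) ×
    (∀ m → Reach [ i ] m → Σ Marking λ m' → Reach m m' × (m' ≐ [ o ])) ×
    (∀ m → Reach [ i ] m → 1 ≤ m o → m ≐ [ o ])

  SafeSoundWF : Fin np → Fin np → Set
  SafeSoundWF i o = IsWFNet i o × Safe i × Sound i o

  -- PTR(p, p'): transitions on some path p = p1 t1 p2 ... tn p(n+1) = p'
  -- with p_k ≠ p' for k ≤ n.
  data Walk (p' : Fin np) : Fin np → List (Fin nt) → Set where
    done : Walk p' p' []
    step : ∀ {p t q ts} → p ≢ p' → T (trans N t) → T (pre N p t) → T (post N t q) →
           Walk p' q ts → Walk p' p (t ∷ ts)

  PTR : Fin np → Fin np → Fin nt → Set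
  PTR p p' t = Σ (List (Fin nt)) λ ts → Walk p' p ts × t ∈ ts

  IsPartition3 : (Fin nt → Bool) → (Fin nt → Bool) → (Fin nt → Bool) → Set
  IsPartition3 X Y Z =
    (∀ t → T (trans N t) ⇔ (T (X t) ⊎ T (Y t) ⊎ T (Z t))) ×
    (∀ t → T (X t) → T (Y t) → ⊥) ×
    (∀ t → T (X t) → T (Z t) → ⊥) ×
    (∀ t → T (Y t) → T (Z t) → ⊥) ×
    (∃ λ t → T (X t)) × (∃ λ t → T (Y t)) × (∃ λ t → T (Z t))

  IsLoopPattern : Fin np → Fin np → (Tdo Tredo Tτ : Fin nt → Bool) → Fin np → Fin np → Set
  IsLoopPattern i o Tdo Tredo Tτ pdo predo =
    SafeSoundWF i o ×
    IsPartition3 Tdo Tredo Tτ ×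
    T (place N pdo) × T (place N predo) ×
    Σ (Fin nt) λ tsource → Σ (Fin nt) λ tsink →
      (∀ t → T (Tτ t) ⇔ (t ≡ tsource ⊎ t ≡ tsink)) ×
      tsource ≢ tsink × label N tsource ≡ nothing × label N tsink ≡ nothing ×
      (∀ t → T (pre N i t) ⇔ (t ≡ tsource)) ×
      (∀ t → T (post N t o) ⇔ (t ≡ tsink)) ×
      (∀ p → T (pre N p tsource) ⇔ (p ≡ i)) ×
      (∀ p → T (post N tsource p) ⇔ (p ≡ pdo)) ×
      (∀ p → T (pre N p tsink) ⇔ (p ≡ predo)) ×
      (∀ p → T (post N tsink p) ⇔ (p ≡ o)) ×
      (∀ t → T (Tdo t) ⇔ PTR pdo predo t) ×
      (∀ t → T (Tredo t) ⇔ PTR predo pdo t) ×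
      (∀ t → T (post N t pdo) → T (Tdo t) → ⊥) ×
      (∀ t → T (post N t predo) → T (Tredo t) → ⊥) ×
      (∀ t → T (pre N predo t) → T (Tdo t) → ⊥) ×
      (∀ t → T (pre N pdo t) → T (Tredo t) → ⊥)

anyFin : ∀ {n} → (Fin n → Bool) → Bool
anyFin {zero}  f = false
anyFin {suc n} f = f zero ∨ anyFin (λ k → f (suc k))

_==_ : ∀ {n} → Fin n → Fin n → Bool
p == q = ⌊ p ≟ q ⌋

-- loopproject(N, T') where (pstart, pend) = (pdo, predo) for T' = Tdo
-- and (predo, pdo) for T' = Tredo; i, o are i_N, o_N.
-- Note {pstart, pend} = {pdo, predo}, so P' removes both.
loopproject : ∀ {A np nt} → Net A np nt → (i o : Fin np) → (pstart pend : Fin np) →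
              (T' : Fin nt → Bool) → Net A np nt
loopproject {A} {np} {nt} N i o pstart pend T' = record
  { place = place'
  ; trans = T'
  ; pre   = λ p t → (pre N p t ∧ place' p ∧ T' t) ∨ ((p == i) ∧ T' t ∧ pre N pstart t)
  ; post  = λ t p → (post N t p ∧ place' p ∧ T' t) ∨ ((p == o) ∧ T' t ∧ post N t pend)
  ; label = label N
  }
  where
  inPT' : Fin np → Bool
  inPT' p = place N p ∧ anyFin (λ t → T' t ∧ (post N t p ∨ pre N p t))
  place' : Fin np → Bool
  place' p = (inPT' p ∧ not (p == pstart) ∧ not (p == pend)) ∨ (p == i) ∨ (p == o)

-- Fix one side of the loop: Tx = PTR(ps, pe) with {ps, pe} = {pdo, predo}. Structurally, an interior
-- place next to Tx is entered from ps without crossing pdo or predo, and all its adjacent transitions lie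
-- in Tx (were it also entered from pe, its output transitions would lie in both PTR sets). Behaviourally,
-- soundness makes pdo and predo exclusive: a reachable marking with a token there is [pdo] resp. [predo].
-- Hence every reachable marking is either inside an execution of Tx started from [ps], or has no token
-- in ps or in the interior of Tx. The projection is Tx with ps and pe renamed to i and o; renaming
-- markings accordingly maps executions of Tx onto the runs of the projection and back, which transfers
-- safeness and the three soundness conditions, while PTR walks supply the paths of the WF-net.

module Submission where

open import Defs renaming (trans to transition)
open import Data.Nat using (ℕ; zero; suc; _+_; _∸_; _≤_; z≤n; s≤s)
open import Data.Nat.Properties
  using (+-comm; +-identityʳ; +-cancelˡ-≡; +-cancelʳ-≡; +-∸-comm; m∸n+n≡m; m+[n∸m]≡n;
         0∸n≡0; n≮0; m∸n≤m; m≤m+n; m≤n+m; ≤-trans; ≤-reflexive; +-commutativeSemigroup)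
open import Algebra.Properties.CommutativeSemigroup +-commutativeSemigroup using (xy∙z≈xz∙y)
open import Data.Fin using (Fin; _≟_)
open import Data.Bool using (Bool; true; false; T; T?; _∧_; _∨_; not; if_then_else_)
open import Data.Bool.Properties using (T-∧; T-∨)
open import Data.Product using (Σ; ∃; _×_; _,_; proj₁; proj₂)
open import Data.Sum using (_⊎_; inj₁; inj₂; [_,_]′; swap)
open import Data.Empty using (⊥; ⊥-elim)
open import Data.List using (List; []; _∷_; _++_)
open import Data.List.Membership.Propositional using (_∈_)
open import Data.List.Membership.Propositional.Properties using (∈-++⁺ˡ; ∈-++⁺ʳ)
open import Data.List.Relation.Unary.Any using (here; there)
open import Function using (_∘_)
open import Function.Bundles using (_⇔_; mk⇔; Equivalence)
open import Function.Construct.Composition using (_⇔-∘_)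
open import Function.Construct.Symmetry using (⇔-sym)
open import Relation.Nullary using (¬_; yes; no)
open import Relation.Nullary.Decidable using (Dec; _⊎-dec_; toWitness; fromWitness; dec-true; dec-false; isYes≗does)
open import Relation.Binary.PropositionalEquality
  using (_≡_; _≢_; _≗_; refl; sym; trans; cong; cong₂; subst; module ≡-Reasoning)
open import Relation.Binary.Construct.Closure.ReflexiveTransitive using (Star; ε; _◅_; _◅◅_; gmap)
import Relation.Binary.Construct.Closure.ReflexiveTransitive as Star

open Equivalence using (to; from)

T-== : ∀ {n} {p q : Fin n} → T (p == q) ⇔ p ≡ q
T-== = mk⇔ toWitness fromWitness

==-true : ∀ {n} {p q : Fin n} → p ≡ q → (p == q) ≡ true
==-true {p = p} {q} p≡q = trans (isYes≗does (p ≟ q)) (dec-true (p ≟ q) p≡q)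

==-false : ∀ {n} {p q : Fin n} → p ≢ q → (p == q) ≡ false
==-false {p = p} {q} p≢q = trans (isYes≗does (p ≟ q)) (dec-false (p ≟ q) p≢q)

T-not-== : ∀ {n} {p q : Fin n} → T (not (p == q)) ⇔ p ≢ q
T-not-== = mk⇔ (λ h p≡q → subst (T ∘ not) (==-true p≡q) h) (λ p≢q → subst (T ∘ not) (sym (==-false p≢q)) _)

T-anyFin : ∀ {n} {f : Fin n → Bool} → T (anyFin f) ⇔ ∃ λ k → T (f k)
T-anyFin {n} {f} = mk⇔ (witness n f) (intro n f)
  where
  witness : ∀ n (f : Fin n → Bool) → T (anyFin f) → ∃ λ k → T (f k)
  witness (suc n) f h with to (T-∨ {f Fin.zero}) h
  ... | inj₁ h₀ = Fin.zero , h₀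
  ... | inj₂ h₁ = let (k , hk) = witness n (f ∘ Fin.suc) h₁ in Fin.suc k , hk
  intro : ∀ n (f : Fin n → Bool) → (∃ λ k → T (f k)) → T (anyFin f)
  intro (suc n) f (Fin.zero , h)  = from (T-∨ {f Fin.zero}) (inj₁ h)
  intro (suc n) f (Fin.suc k , h) = from (T-∨ {f Fin.zero}) (inj₂ (intro n (f ∘ Fin.suc) (k , h)))

b2n-cong : ∀ {A np nt} {N : Net A np nt} {a b : Bool} → (T a ⇔ T b) → b2n N a ≡ b2n N b
b2n-cong {a = true}  {true}  _   = refl
b2n-cong {a = false} {false} _   = refl
b2n-cong {a = true}  {false} a⇔b = ⊥-elim (to a⇔b _)
b2n-cong {a = false} {true}  a⇔b = ⊥-elim (from a⇔b _)

module Firing {A : Set} {np nt : ℕ} (N : Net A np nt) where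

  ⟦_⟧ : Fin np → Marking N
  ⟦_⟧ = [_] N

  singleton-≡ : ∀ {a b x y} → (a ≡ x ⇔ b ≡ y) → ⟦ x ⟧ a ≡ ⟦ y ⟧ b
  singleton-≡ a⇔b = b2n-cong {N = N} ((⇔-sym T-== ⇔-∘ a⇔b) ⇔-∘ T-==)

  b2n-singleton : ∀ {c : Bool} {q p} → (T c ⇔ q ≡ p) → b2n N c ≡ ⟦ p ⟧ q
  b2n-singleton c⇔q≡p = b2n-cong {N = N} (⇔-sym T-== ⇔-∘ c⇔q≡p)

  singleton-self : ∀ p → ⟦ p ⟧ p ≡ 1
  singleton-self p = cong (if_then 1 else 0) (==-true {p = p} refl)

  singleton-other : ∀ {p q} → q ≢ p → ⟦ p ⟧ q ≡ 0
  singleton-other q≢p = cong (if_then 1 else 0) (==-false q≢p)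

  singleton-support : ∀ {m p} q → m ≗ ⟦ p ⟧ → 1 ≤ m q → q ≡ p
  singleton-support {p = p} q m≗p 1≤mq with q ≟ p
  ... | yes q≡p = q≡p
  ... | no q≢p  = ⊥-elim (n≮0 (subst (1 ≤_) (trans (m≗p q) (singleton-other q≢p)) 1≤mq))

  _⊕_ : Marking N → Marking N → Marking N
  (a ⊕ b) p = a p + b p

  _⊖_ : Marking N → Marking N → Marking N
  (a ⊖ b) p = a p ∸ b p

  ⊕-⊖ : ∀ {a m : Marking N} → (∀ q → a q ≤ m q) → m ≗ a ⊕ (m ⊖ a)
  ⊕-⊖ a≤m q = sym (m+[n∸m]≡n (a≤m q))

  singleton-≤ : ∀ {a m : Marking N} {p} → a ≗ ⟦ p ⟧ → 1 ≤ m p → ∀ q → a q ≤ m q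
  singleton-≤ {m = m} {p} a≗p 1≤mp q = subst (_≤ m q) (sym (a≗p q)) (≤-by-case q)
    where
    ≤-by-case : ∀ q → ⟦ p ⟧ q ≤ m q
    ≤-by-case q with q ≟ p
    ... | yes refl = 1≤mp
    ... | no _     = z≤n

  enabled-resp : ∀ {a b t} → a ≗ b → Enabled N b t → Enabled N a t
  enabled-resp a≗b (t∈T , marked) = t∈T , λ p p∈•t → subst (1 ≤_) (sym (a≗b p)) (marked p p∈•t)

  fire-resp : ∀ {a b} t → a ≗ b → fire N a t ≗ fire N b t
  fire-resp t a≗b p = cong (λ n → n ∸ b2n N (pre N p t) + b2n N (post N t p)) (a≗b p)

  step-resp : ∀ {a b c} → a ≗ b → Step N b c → Step N a c
  step-resp a≗b (t , enabled , c≗) =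
    t , enabled-resp a≗b enabled , λ p → trans (c≗ p) (sym (fire-resp t a≗b p))

  infix 4 _⇝_
  _⇝_ : Marking N → Marking N → Set
  a ⇝ b = Σ (Marking N) λ b′ → Reach N a b′ × b′ ≗ b

  reach-resp : ∀ {a b c} → a ≗ b → Reach N b c → a ⇝ c
  reach-resp {a} a≗b ε       = a , ε , a≗b
  reach-resp     a≗b (s ◅ r) = _ , step-resp a≗b s ◅ r , λ _ → refl

  consumed-≤ : ∀ {a t} p → Enabled N a t → b2n N (pre N p t) ≤ a p
  consumed-≤ {t = t} p (_ , marked) with pre N p t in p∈•t
  ... | false = z≤n
  ... | true  = marked p (subst T (sym p∈•t) _)

  fire-+-consumed : ∀ {a t} p → Enabled N a t →
                    fire N a t p + b2n N (pre N p t) ≡ a p + b2n N (post N t p)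
  fire-+-consumed {a} {t} p enabled =
    trans (xy∙z≈xz∙y (a p ∸ b2n N (pre N p t)) _ _)
          (cong (_+ b2n N (post N t p)) (m∸n+n≡m (consumed-≤ p enabled)))

  module _ {t p q} (•t≡p : ∀ r → T (pre N r t) ⇔ r ≡ p) (t•≡q : ∀ r → T (post N t r) ⇔ r ≡ q) where

    enabled-if-marked : ∀ {a} → T (transition N t) → 1 ≤ a p → Enabled N a t
    enabled-if-marked {a} t∈T 1≤ap =
      t∈T , λ r r∈•t → subst (λ x → 1 ≤ a x) (sym (to (•t≡p r) r∈•t)) 1≤ap

    fire-moves : ∀ {a} → Enabled N a t → ∀ r → fire N a t r + ⟦ p ⟧ r ≡ a r + ⟦ q ⟧ r
    fire-moves {a} enabled r = begin
      fire N a t r + ⟦ p ⟧ r               ≡⟨ cong (fire N a t r +_) (sym (b2n-singleton (•t≡p r))) ⟩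
      fire N a t r + b2n N (pre N r t)     ≡⟨ fire-+-consumed r enabled ⟩
      a r + b2n N (post N t r)             ≡⟨ cong (a r +_) (b2n-singleton (t•≡q r)) ⟩
      a r + ⟦ q ⟧ r                        ∎
      where open ≡-Reasoning

    fire-singleton : Enabled N ⟦ p ⟧ t → fire N ⟦ p ⟧ t ≗ ⟦ q ⟧
    fire-singleton enabled r =
      +-cancelʳ-≡ (⟦ p ⟧ r) _ _ (trans (fire-moves enabled r) (+-comm (⟦ p ⟧ r) (⟦ q ⟧ r)))

  fire-⊕ : ∀ {a t} X → Enabled N a t → fire N (a ⊕ X) t ≗ fire N a t ⊕ X
  fire-⊕ {a} {t} X enabled p =
    trans (cong (_+ b2n N (post N t p)) (+-∸-comm (X p) (consumed-≤ p enabled)))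
          (xy∙z≈xz∙y (a p ∸ b2n N (pre N p t)) (X p) _)

  step-⊕ : ∀ {a b} X → Step N a b → Step N (a ⊕ X) (b ⊕ X)
  step-⊕ {a} X (t , enabled@(t∈T , marked) , b≗) =
    t , (t∈T , λ p p∈•t → ≤-trans (marked p p∈•t) (m≤m+n (a p) (X p))) ,
    λ p → trans (cong (_+ X p) (b≗ p)) (sym (fire-⊕ X enabled p))

  reach-⊕ : ∀ {a b} X → Reach N a b → Reach N (a ⊕ X) (b ⊕ X)
  reach-⊕ X = gmap (_⊕ X) (step-⊕ X)

  fire-marked : ∀ {a t} p → 1 ≤ fire N a t p → 1 ≤ a p ⊎ T (post N t p)
  fire-marked {a} {t} p 1≤ with post N t p
  ... | true  = inj₂ _
  ... | false = inj₁ (≤-trans 1≤ (≤-trans (≤-reflexive (+-identityʳ _)) (m∸n≤m (a p) (b2n N (pre N p t)))))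

  fire-produces : ∀ {a t} p → T (post N t p) → 1 ≤ fire N a t p
  fire-produces {a} {t} p p∈t• with post N t p
  ... | true = ≤-trans (s≤s z≤n) (m≤n+m 1 (a p ∸ b2n N (pre N p t)))

  fire-consumes : ∀ {a t} p → a p ≡ 1 → T (pre N p t) → ¬ T (post N t p) → fire N a t p ≡ 0
  fire-consumes {t = t} p ap≡1 p∈•t p∉t• with pre N p t | post N t p
  ... | true | true  = ⊥-elim (p∉t• _)
  ... | true | false rewrite ap≡1 = refl

  fire-unmarked : ∀ {a t} p → a p ≡ 0 → ¬ T (post N t p) → fire N a t p ≡ 0
  fire-unmarked {t = t} p ap≡0 p∉t• with post N t p
  ... | true  = ⊥-elim (p∉t• _)
  ... | false rewrite ap≡0 = trans (+-identityʳ _) (0∸n≡0 (b2n N (pre N p t)))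

  first-production : ∀ {a c} p → Reach N a c → a p ≡ 0 → 1 ≤ c p →
                     ∃ λ m → ∃ λ t → Reach N a m × Enabled N m t × T (post N t p)
  first-production p ε ap≡0 1≤ap = ⊥-elim (n≮0 (subst (1 ≤_) ap≡0 1≤ap))
  first-production {a} p (_◅_ {j = b} s@(t , enabled , b≗) b→c) ap≡0 1≤cp with b p in bp≡
  ... | zero =
    let (m , u , b→m , enabled′ , u→p) = first-production p b→c bp≡ 1≤cp in m , u , s ◅ b→m , enabled′ , u→p
  ... | suc _ with fire-marked {a} p (subst (1 ≤_) (trans (sym bp≡) (b≗ p)) (s≤s z≤n))
  ...   | inj₂ t→p = a , t , ε , enabled , t→p
  ...   | inj₁ 1≤ap = ⊥-elim (n≮0 (subst (1 ≤_) ap≡0 1≤ap))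

fire-cong : ∀ {A np nt} (N N′ : Net A np nt) {m m′ : Fin np → ℕ} {t p p′} →
            m p ≡ m′ p′ → (T (pre N p t) ⇔ T (pre N′ p′ t)) → (T (post N t p) ⇔ T (post N′ t p′)) →
            fire N m t p ≡ fire N′ m′ t p′
fire-cong N N′ mp≡ pre⇔ post⇔ = cong₂ _+_ (cong₂ _∸_ mp≡ (b2n-cong {N = N} pre⇔)) (b2n-cong {N = N} post⇔)

module Paths {A : Set} {np nt : ℕ} (N : Net A np nt) where

  last-edge : ∀ {x y} → Star (Edge N) x y → x ≡ y ⊎ ∃ λ z → Edge N z y
  last-edge ε = inj₁ refl
  last-edge (e ◅ r) with last-edge r
  ... | inj₁ refl = inj₂ (_ , e)
  ... | inj₂ e′   = inj₂ e′

  first-edge : ∀ {x y} → Star (Edge N) x y → x ≡ y ⊎ ∃ λ z → Edge N x z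
  first-edge ε       = inj₁ refl
  first-edge (e ◅ _) = inj₂ (_ , e)

  has-input-transition : ∀ {a p} → Path N (pl a) (pl p) → a ≢ p → ∃ λ t → T (post N t p)
  has-input-transition path a≢p with last-edge path
  ... | inj₁ refl         = ⊥-elim (a≢p refl)
  ... | inj₂ (_ , tp t→p) = _ , t→p

  has-output-transition : ∀ {p b} → Path N (pl p) (pl b) → p ≢ b → ∃ λ t → T (pre N p t)
  has-output-transition path p≢b with first-edge path
  ... | inj₁ refl         = ⊥-elim (p≢b refl)
  ... | inj₂ (_ , pt p→t) = _ , p→t

  has-input-place : ∀ {a t} → Path N (pl a) (tr t) → ∃ λ q → T (pre N q t)
  has-input-place path with last-edge path
  ... | inj₂ (_ , pt q→t) = _ , q→t

  has-output-place : ∀ {t b} → Path N (tr t) (pl b) → ∃ λ q → T (post N t q)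
  has-output-place path with first-edge path
  ... | inj₂ (_ , tp t→q) = _ , t→q

  source-unique : ∀ {i} → (∀ p → T (place N p) → Path N (pl i) (pl p)) →
                  ∀ p → T (place N p) → (∀ t → ¬ T (post N t p)) → p ≡ i
  source-unique {i} paths p p∈P no-input with p ≟ i
  ... | yes p≡i = p≡i
  ... | no p≢i  = let (t , t→p) = has-input-transition (paths p p∈P) (p≢i ∘ sym) in ⊥-elim (no-input t t→p)

  sink-unique : ∀ {o} → (∀ p → T (place N p) → Path N (pl p) (pl o)) →
                ∀ p → T (place N p) → (∀ t → ¬ T (pre N p t)) → p ≡ o
  sink-unique {o} paths p p∈P no-output with p ≟ o
  ... | yes p≡o = p≡o
  ... | no p≢o  = let (t , p→t) = has-output-transition (paths p p∈P) p≢o in ⊥-elim (no-output t p→t)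

module SoundNet {A : Set} {np nt : ℕ} (N : Net A np nt) {i o : Fin np}
  (completable : ∀ m → Reach N ([_] N i) m → Σ (Marking N) λ m′ → Reach N m m′ × _≐_ N m′ ([_] N o))
  (proper : ∀ m → Reach N ([_] N i) m → 1 ≤ m o → _≐_ N m ([_] N o))
  where
  open Firing N

  Exclusive : Fin np → Set
  Exclusive p = ∀ m → Reach N ⟦ i ⟧ m → 1 ≤ m p → m ≗ ⟦ p ⟧

  -- m splits as a ⊕ (m ⊖ a) with a ≗ [p]; completing a to [o] inside m reaches [o] ⊕ (m ⊖ a),
  -- which properness forces to be [o], so m ⊖ a vanishes.
  exclusive-if-reachable : ∀ {p} → ⟦ i ⟧ ⇝ ⟦ p ⟧ → Exclusive p
  exclusive-if-reachable {p} (a , i→a , a≗p) m i→m 1≤mp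
    with completable a i→a
  ... | c , a→c , c≗o with reach-resp (⊕-⊖ (singleton-≤ a≗p 1≤mp)) (reach-⊕ (m ⊖ a) a→c)
  ...   | c′ , m→c′ , c′≗c⊕rest =
    λ q → trans (⊕-⊖ a≤m q) (trans (cong (a q +_) (rest≗0 q)) (trans (+-identityʳ (a q)) (a≗p q)))
    where
    a≤m : ∀ q → a q ≤ m q
    a≤m = singleton-≤ a≗p 1≤mp

    c′≗o : c′ ≗ ⟦ o ⟧
    c′≗o = proper c′ (i→m ◅◅ m→c′)
      (subst (1 ≤_) (sym (trans (c′≗c⊕rest o) (cong (_+ (m ⊖ a) o) (trans (c≗o o) (singleton-self o)))))
             (s≤s z≤n))

    rest≗0 : ∀ q → (m ⊖ a) q ≡ 0
    rest≗0 q = +-cancelˡ-≡ (⟦ o ⟧ q) _ 0 (begin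
      ⟦ o ⟧ q + (m ⊖ a) q ≡⟨ cong (_+ (m ⊖ a) q) (sym (c≗o q)) ⟩
      c q + (m ⊖ a) q     ≡⟨ sym (c′≗c⊕rest q) ⟩
      c′ q                ≡⟨ c′≗o q ⟩
      ⟦ o ⟧ q             ≡⟨ sym (+-identityʳ _) ⟩
      ⟦ o ⟧ q + 0         ∎)
      where open ≡-Reasoning

  exclusive-if-sole-input : ∀ {p t} → T (transition N t) →
                            (∀ q → T (pre N q t) ⇔ q ≡ p) → (∀ q → T (post N t q) ⇔ q ≡ o) → Exclusive p
  exclusive-if-sole-input {p} {t} t∈T •t≡p t•≡o m i→m 1≤mp q =
    +-cancelʳ-≡ (⟦ o ⟧ q) (m q) (⟦ p ⟧ q) (begin
      m q + ⟦ o ⟧ q          ≡⟨ sym (fire-moves •t≡p t•≡o enabled q) ⟩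
      fire N m t q + ⟦ p ⟧ q ≡⟨ cong (_+ ⟦ p ⟧ q) (fired≗o q) ⟩
      ⟦ o ⟧ q + ⟦ p ⟧ q      ≡⟨ +-comm (⟦ o ⟧ q) _ ⟩
      ⟦ p ⟧ q + ⟦ o ⟧ q      ∎)
    where
    open ≡-Reasoning
    enabled : Enabled N m t
    enabled = enabled-if-marked •t≡p t•≡o t∈T 1≤mp

    fired≗o : fire N m t ≗ ⟦ o ⟧
    fired≗o = proper (fire N m t) (i→m ◅◅ ((t , enabled , λ _ → refl) ◅ ε))
                     (fire-produces {m} o (from (t•≡o o) refl))

module Loop {A : Set} {np nt : ℕ} (N : Net A np nt) {i o pdo predo : Fin np} {tsource tsink : Fin nt}
  (flow-pre : ∀ p t → T (pre N p t) → T (place N p) × T (transition N t))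
  (flow-post : ∀ t p → T (post N t p) → T (transition N t) × T (place N p))
  (i-no-input : ∀ t → ¬ T (post N t i))
  (o-no-output : ∀ t → ¬ T (pre N o t))
  (place-paths : ∀ p → T (place N p) → Path N (pl i) (pl p) × Path N (pl p) (pl o))
  (transition-paths : ∀ t → T (transition N t) → Path N (pl i) (tr t) × Path N (tr t) (pl o))
  (safe : Safe N i)
  (live : ∀ t → T (transition N t) → Σ (Marking N) λ m → Reach N ([_] N i) m × Enabled N m t)
  (completable : ∀ m → Reach N ([_] N i) m → Σ (Marking N) λ m′ → Reach N m m′ × _≐_ N m′ ([_] N o))
  (proper : ∀ m → Reach N ([_] N i) m → 1 ≤ m o → _≐_ N m ([_] N o))
  (i-outputs : ∀ t → T (pre N i t) ⇔ (t ≡ tsource))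
  (o-inputs : ∀ t → T (post N t o) ⇔ (t ≡ tsink))
  (source-inputs : ∀ p → T (pre N p tsource) ⇔ (p ≡ i))
  (source-outputs : ∀ p → T (post N tsource p) ⇔ (p ≡ pdo))
  (sink-inputs : ∀ p → T (pre N p tsink) ⇔ (p ≡ predo))
  (sink-outputs : ∀ p → T (post N tsink p) ⇔ (p ≡ o))
  (source≢sink : tsource ≢ tsink)
  where

  open Firing N
  open Paths N
  open SoundNet N completable proper

  i≢o : i ≢ o
  i≢o refl = o-no-output tsource (from (source-inputs i) refl)

  Boundary : Fin np → Set
  Boundary p = p ≡ pdo ⊎ p ≡ predo

  boundary? : ∀ p → Dec (Boundary p)
  boundary? p = (p ≟ pdo) ⊎-dec (p ≟ predo)

  boundary-or-interior : ∀ p → Boundary p ⊎ ¬ Boundary p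
  boundary-or-interior p with boundary? p
  ... | yes p-bnd = inj₁ p-bnd
  ... | no p-int  = inj₂ p-int

  boundary≢i : ∀ {p} → Boundary p → p ≢ i
  boundary≢i (inj₁ refl) refl = i-no-input tsource (from (source-outputs pdo) refl)
  boundary≢i (inj₂ refl) refl = source≢sink (sym (to (i-outputs tsink) (from (sink-inputs predo) refl)))

  boundary≢o : ∀ {p} → Boundary p → p ≢ o
  boundary≢o (inj₁ refl) refl = source≢sink (to (o-inputs tsource) (from (source-outputs pdo) refl))
  boundary≢o (inj₂ refl) refl = o-no-output tsink (from (sink-inputs predo) refl)

  source-transition : T (transition N tsource)
  source-transition = proj₂ (flow-pre i tsource (from (source-inputs i) refl))

  sink-transition : T (transition N tsink)
  sink-transition = proj₂ (flow-pre predo tsink (from (sink-inputs predo) refl))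

  i→pdo : Reach N ⟦ i ⟧ ⟦ pdo ⟧
  i→pdo = (tsource , enabled , λ p → sym (fire-singleton source-inputs source-outputs enabled p)) ◅ ε
    where
    enabled : Enabled N ⟦ i ⟧ tsource
    enabled = enabled-if-marked source-inputs source-outputs source-transition
                                (subst (1 ≤_) (sym (singleton-self i)) (s≤s z≤n))

  predo-exclusive : Exclusive predo
  predo-exclusive = exclusive-if-sole-input sink-transition sink-inputs sink-outputs

  -- The first transition marking o on a run from [pdo] to [o] is tsink, which needs a token in predo.
  i⇝predo : ⟦ i ⟧ ⇝ ⟦ predo ⟧
  i⇝predo with completable ⟦ pdo ⟧ i→pdo
  ... | c , pdo→c , c≗o
    with first-production o pdo→c (singleton-other (boundary≢o (inj₁ refl) ∘ sym))
                          (subst (1 ≤_) (sym (trans (c≗o o) (singleton-self o))) (s≤s z≤n))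
  ...   | m , t , pdo→m , enabled , t→o =
    m , i→m , predo-exclusive m i→m (proj₂ enabled predo predo→t)
    where
    i→m : Reach N ⟦ i ⟧ m
    i→m = i→pdo ◅◅ pdo→m
    predo→t : T (pre N predo t)
    predo→t = subst (T ∘ pre N predo) (sym (to (o-inputs t) t→o)) (from (sink-inputs predo) refl)

  boundary-reachable : ∀ {p} → Boundary p → ⟦ i ⟧ ⇝ ⟦ p ⟧
  boundary-reachable (inj₁ refl) = ⟦ pdo ⟧ , i→pdo , λ _ → refl
  boundary-reachable (inj₂ refl) = i⇝predo

  boundary-exclusive : ∀ {p} → Boundary p → Exclusive p
  boundary-exclusive p-bnd = exclusive-if-reachable (boundary-reachable p-bnd)

  Hop : Fin np → Fin nt → Fin np → Set
  Hop a t b = T (transition N t) × T (pre N a t) × T (post N t b)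

  hop-of : ∀ {a t b} → T (pre N a t) → T (post N t b) → Hop a t b
  hop-of {a} {t} a→t t→b = proj₂ (flow-pre a t a→t) , a→t , t→b

  data AvoidingWalk (Bad : Fin np → Set) : Fin np → Fin np → List (Fin nt) → Set where
    done : ∀ {a} → AvoidingWalk Bad a a []
    hop  : ∀ {a t b c ts} → ¬ Bad a → Hop a t b → AvoidingWalk Bad b c ts → AvoidingWalk Bad a c (t ∷ ts)

  _++ʷ_ : ∀ {Bad a b c ts us} → AvoidingWalk Bad a b ts → AvoidingWalk Bad b c us → AvoidingWalk Bad a c (ts ++ us)
  done          ++ʷ w′ = w′
  hop a-ok h w  ++ʷ w′ = hop a-ok h (w ++ʷ w′)

  weaken : ∀ {Bad Bad′ : Fin np → Set} {a b ts} → (∀ {p} → Bad′ p → Bad p) →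
           AvoidingWalk Bad a b ts → AvoidingWalk Bad′ a b ts
  weaken Bad′⊆Bad done            = done
  weaken Bad′⊆Bad (hop a-ok h w) = hop (a-ok ∘ Bad′⊆Bad) h (weaken Bad′⊆Bad w)

  avoiding-from-walk : ∀ {e s ts} → Walk N e s ts → AvoidingWalk (_≡ e) s e ts
  avoiding-from-walk done                      = done
  avoiding-from-walk (step s≢e t∈T s→t t→b w) = hop s≢e (t∈T , s→t , t→b) (avoiding-from-walk w)

  walk-from-avoiding : ∀ {e s ts} → AvoidingWalk (_≡ e) s e ts → Walk N e s ts
  walk-from-avoiding done                          = done
  walk-from-avoiding (hop s≢e (t∈T , s→t , t→b) w) = step s≢e t∈T s→t t→b (walk-from-avoiding w)

  first-hop : ∀ {Bad a b ts} → AvoidingWalk Bad a b ts → a ≢ b → ∃ λ t → T (pre N a t) × t ∈ ts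
  first-hop done              a≢b = ⊥-elim (a≢b refl)
  first-hop (hop _ (_ , a→t , _) _) _ = _ , a→t , here refl

  data Entry (x q : Fin np) : List (Fin nt) → Set where
    entry : ∀ {t a ts} → Hop x t a → AvoidingWalk Boundary a q ts → Entry x q (t ∷ ts)

  entry-walk : ∀ {x e q ts} → Boundary e → x ≢ e → Entry x q ts → AvoidingWalk (_≡ e) x q ts
  entry-walk e-bnd x≢e (entry h w) = hop x≢e h (weaken (λ { refl → e-bnd }) w)

  -- Leaving a: the only way into o is from predo, so a path to o meets the boundary.
  exit-boundary : ∀ {a} → Path N (pl a) (pl o) → a ≢ o →
                  ∃ λ x → Boundary x × ∃ λ ts → AvoidingWalk Boundary a x ts
  exit-boundary ε a≢o = ⊥-elim (a≢o refl)
  exit-boundary {a} (pt {t = t} a→t ◅ tp {p = b} t→b ◅ b→o) a≢o with boundary? a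
  ... | yes a-bnd = a , a-bnd , [] , done
  ... | no a-int with b ≟ o
  ...   | yes refl = ⊥-elim (a-int (inj₂ (to (sink-inputs a) (subst (T ∘ pre N a) (to (o-inputs t) t→b) a→t))))
  ...   | no b≢o   = let (x , x-bnd , ts , w) = exit-boundary b→o b≢o
                     in x , x-bnd , t ∷ ts , hop a-int (hop-of a→t t→b) w

  EnteredThrough : Fin np → Fin nt → Fin np → Set
  EnteredThrough x t q = ∃ λ ts → Entry x q ts × t ∈ ts

  InteriorOrEntered : Fin np → Fin nt → Fin np → Set
  InteriorOrEntered a t q =
    (∃ λ x → Boundary x × EnteredThrough x t q) ⊎ (∃ λ ts → AvoidingWalk Boundary a q ts × t ∈ ts)

  prepend-hop : ∀ {a u b q ts t} → T (pre N a u) → T (post N u b) → AvoidingWalk Boundary b q ts → t ∈ u ∷ ts →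
                InteriorOrEntered a t q
  prepend-hop {a} a→u u→b w t∈ with boundary? a
  ... | yes a-bnd = inj₁ (a , a-bnd , _ , entry (hop-of a→u u→b) w , t∈)
  ... | no a-int  = inj₂ (_ , hop a-int (hop-of a→u u→b) w , t∈)

  last-entry : ∀ {a t q} → Path N (pl a) (tr t) → T (post N t q) → InteriorOrEntered a t q
  last-entry (pt a→t ◅ ε) t→q = prepend-hop a→t t→q done (here refl)
  last-entry (pt a→u ◅ tp u→b ◅ rest) t→q with last-entry rest t→q
  ... | inj₁ entered         = inj₁ entered
  ... | inj₂ (ts , w , t∈) = prepend-hop a→u u→b w (there t∈)

  -- Every walk out of i starts with tsource into the boundary place pdo.
  entry-boundary : ∀ {t q} → T (post N t q) → ¬ Boundary q → ∃ λ x → Boundary x × EnteredThrough x t q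
  entry-boundary {t} {q} t→q q-int with last-entry (proj₁ (transition-paths t (proj₁ (flow-post t q t→q)))) t→q
  ... | inj₁ entered = entered
  ... | inj₂ ([] , _ , ())
  ... | inj₂ (_ ∷ _ , hop _ (_ , i→u , u→b) w , _)
    with to (i-outputs _) i→u
  ...   | refl with to (source-outputs _) u→b
  ...     | refl with w
  ...       | done           = ⊥-elim (q-int (inj₁ refl))
  ...       | hop pdo-int _ _ = ⊥-elim (pdo-int (inj₁ refl))

  module Closure {s e : Fin np} {Ts : Fin nt → Bool}
    (e-boundary : Boundary e)
    (cover : ∀ x → Boundary x → x ≡ s ⊎ x ≡ e)
    (Ts-PTR : ∀ t → T (Ts t) ⇔ PTR N s e t)
    (Ts-nonempty : ∃ λ t → T (Ts t))
    where

    avoids-e : ∀ {p} → p ≡ e → Boundary p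
    avoids-e refl = e-boundary

    closed-walk : ∀ {ts t} → AvoidingWalk (_≡ e) s e ts → t ∈ ts → T (Ts t)
    closed-walk {ts} w t∈ = from (Ts-PTR _) (ts , walk-from-avoiding w , t∈)

    PTR-walk : ∃ λ ts → AvoidingWalk (_≡ e) s e ts × ∃ λ t → t ∈ ts
    PTR-walk with to (Ts-PTR (proj₁ Ts-nonempty)) (proj₂ Ts-nonempty)
    ... | ts , w , t∈ = ts , avoiding-from-walk w , _ , t∈

    s≢e : s ≢ e
    s≢e refl with PTR-walk
    ... | _ , done , _ , ()
    ... | _ , hop s≢s _ _ , _ = s≢s refl

    Ts-transition : ∀ {t} → T (Ts t) → T (transition N t)
    Ts-transition {t} t∈Ts with to (Ts-PTR t) t∈Ts
    ... | ts , w , t∈ = on-walk (avoiding-from-walk w) t∈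
      where
      on-walk : ∀ {Bad a b ts t} → AvoidingWalk Bad a b ts → t ∈ ts → T (transition N t)
      on-walk (hop _ (t∈T , _) _) (here refl) = t∈T
      on-walk (hop _ _ w)         (there t∈)  = on-walk w t∈

    first-transition : ∃ λ t → T (Ts t) × T (pre N s t)
    first-transition with PTR-walk
    ... | _ , w , _ with first-hop w s≢e
    ...   | t , s→t , t∈ = t , closed-walk w t∈ , s→t

    -- Continue the walk until it first meets the boundary: at e it is a PTR walk already,
    -- at s it is closed into one by appending PTR-walk.
    closed-forward : ∀ {a ts t} → AvoidingWalk (_≡ e) s a ts → T (place N a) → a ≢ o → t ∈ ts → T (Ts t)
    closed-forward {a} w a∈P a≢o t∈ with exit-boundary (proj₂ (place-paths a a∈P)) a≢o
    ... | x , x-bnd , _ , a→x with cover x x-bnd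
    ...   | inj₁ refl = closed-walk (w ++ʷ (weaken avoids-e a→x ++ʷ proj₁ (proj₂ PTR-walk))) (∈-++⁺ˡ t∈)
    ...   | inj₂ refl = closed-walk (w ++ʷ weaken avoids-e a→x) (∈-++⁺ˡ t∈)

    closed-output : ∀ {q ts t} → AvoidingWalk (_≡ e) s q ts → ¬ Boundary q → T (pre N q t) → T (Ts t)
    closed-output {q} {ts} {t} w q-int q→t with has-output-place (proj₂ (transition-paths t (proj₂ (flow-pre q t q→t))))
    ... | b , t→b = closed-forward (w ++ʷ hop (q-int ∘ avoids-e) (hop-of q→t t→b) done)
                                   (proj₂ (flow-post t b t→b)) b≢o (∈-++⁺ʳ ts (here refl))
      where
      b≢o : b ≢ o
      b≢o refl = q-int (inj₂ (to (sink-inputs q) (subst (T ∘ pre N q) (to (o-inputs t) t→b) q→t)))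

  module Side {ps pe : Fin np} {Tx Ty : Fin nt → Bool}
    (ps-boundary : Boundary ps) (pe-boundary : Boundary pe)
    (cover : ∀ x → Boundary x → x ≡ ps ⊎ x ≡ pe)
    (Tx-PTR : ∀ t → T (Tx t) ⇔ PTR N ps pe t)
    (Ty-PTR : ∀ t → T (Ty t) ⇔ PTR N pe ps t)
    (Tx-nonempty : ∃ λ t → T (Tx t))
    (Ty-nonempty : ∃ λ t → T (Ty t))
    (Tx∩Ty : ∀ t → T (Tx t) → T (Ty t) → ⊥)
    (ps-no-Tx-input : ∀ t → T (post N t ps) → T (Tx t) → ⊥)
    (pe-no-Tx-output : ∀ t → T (pre N pe t) → T (Tx t) → ⊥)
    (source∉Tx : ¬ T (Tx tsource))
    (sink∉Tx : ¬ T (Tx tsink))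
    where

    module Forward  = Closure pe-boundary cover Tx-PTR Tx-nonempty
    module Backward = Closure ps-boundary (λ x x-bnd → swap (cover x x-bnd)) Ty-PTR Ty-nonempty

    ps≢pe : ps ≢ pe
    ps≢pe = Forward.s≢e

    forward-walk : ∀ {q ts} → Entry ps q ts → AvoidingWalk (_≡ pe) ps q ts
    forward-walk = entry-walk pe-boundary ps≢pe

    backward-walk : ∀ {q ts} → Entry pe q ts → AvoidingWalk (_≡ ps) pe q ts
    backward-walk = entry-walk ps-boundary (ps≢pe ∘ sym)

    Inner : Fin np → Set
    Inner q = ¬ Boundary q × ∃ λ u → T (Tx u) × (T (pre N q u) ⊎ T (post N u q))

    inner-place : ∀ {q} → Inner q → T (place N q)
    inner-place {q} (_ , u , _ , inj₁ q→u) = proj₁ (flow-pre q u q→u)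
    inner-place {q} (_ , u , _ , inj₂ u→q) = proj₂ (flow-post u q u→q)

    inner≢i : ∀ {q} → Inner q → q ≢ i
    inner≢i (_ , u , u∈Tx , inj₁ i→u) refl = source∉Tx (subst (T ∘ Tx) (to (i-outputs u) i→u) u∈Tx)
    inner≢i (_ , u , _    , inj₂ u→i) refl = i-no-input u u→i

    inner≢o : ∀ {q} → Inner q → q ≢ o
    inner≢o (_ , u , _    , inj₁ o→u) refl = o-no-output u o→u
    inner≢o (_ , u , u∈Tx , inj₂ u→o) refl = sink∉Tx (subst (T ∘ Tx) (to (o-inputs u) u→o) u∈Tx)

    Tx-input : ∀ {q t} → T (Tx t) → T (pre N q t) → q ≡ ps ⊎ Inner q
    Tx-input {q} t∈Tx q→t with boundary? q
    ... | no q-int = inj₂ (q-int , _ , t∈Tx , inj₁ q→t)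
    ... | yes q-bnd with cover q q-bnd
    ...   | inj₁ q≡ps = inj₁ q≡ps
    ...   | inj₂ refl = ⊥-elim (pe-no-Tx-output _ q→t t∈Tx)

    Tx-output : ∀ {q t} → T (Tx t) → T (post N t q) → q ≡ pe ⊎ Inner q
    Tx-output {q} t∈Tx t→q with boundary? q
    ... | no q-int = inj₂ (q-int , _ , t∈Tx , inj₂ t→q)
    ... | yes q-bnd with cover q q-bnd
    ...   | inj₁ refl = ⊥-elim (ps-no-Tx-input _ t→q t∈Tx)
    ...   | inj₂ q≡pe = inj₁ q≡pe

    entered-through : ∀ {t q} → T (post N t q) → ¬ Boundary q → EnteredThrough ps t q ⊎ EnteredThrough pe t q
    entered-through t→q q-int with entry-boundary t→q q-int
    ... | x , x-bnd , entered with cover x x-bnd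
    ...   | inj₁ refl = inj₁ entered
    ...   | inj₂ refl = inj₂ entered

    inner-entered-from-start : ∀ {q} → Inner q → ∃ λ ts → Entry ps q ts
    inner-entered-from-start d@(q-int , u , u∈Tx , inj₂ u→q) with entered-through u→q q-int
    ... | inj₁ (ts , en , _)  = ts , en
    ... | inj₂ (_ , en , u∈) =
      ⊥-elim (Tx∩Ty u u∈Tx (Backward.closed-forward (backward-walk en) (inner-place d) (inner≢o d) u∈))
    inner-entered-from-start {q} d@(q-int , u , u∈Tx , inj₁ q→u)
      with has-input-transition (proj₁ (place-paths q (inner-place d))) (inner≢i d ∘ sym)
    ... | v , v→q with entered-through v→q q-int
    ...   | inj₁ (ts , en , _) = ts , en
    ...   | inj₂ (_ , en , _)  = ⊥-elim (Tx∩Ty u u∈Tx (Backward.closed-output (backward-walk en) q-int q→u))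

    inner-output-in-Tx : ∀ {q t} → Inner q → T (pre N q t) → T (Tx t)
    inner-output-in-Tx d q→t =
      Forward.closed-output (forward-walk (proj₂ (inner-entered-from-start d))) (proj₁ d) q→t

    inner-not-entered-from-end : ∀ {q ts} → Inner q → Entry pe q ts → ⊥
    inner-not-entered-from-end {q} d en with has-output-transition (proj₂ (place-paths q (inner-place d))) (inner≢o d)
    ... | v , q→v = Tx∩Ty v (inner-output-in-Tx d q→v) (Backward.closed-output (backward-walk en) (proj₁ d) q→v)

    inner-input-in-Tx : ∀ {q t} → Inner q → T (post N t q) → T (Tx t)
    inner-input-in-Tx d t→q with entered-through t→q (proj₁ d)
    ... | inj₁ (_ , en , t∈) = Forward.closed-forward (forward-walk en) (inner-place d) (inner≢o d) t∈
    ... | inj₂ (_ , en , _)  = ⊥-elim (inner-not-entered-from-end d en)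

    TxStep : Marking N → Marking N → Set
    TxStep a b = Σ (Fin nt) λ t → T (Tx t) × Enabled N a t × b ≗ fire N a t

    Executing : Marking N → Set
    Executing m = Σ (Marking N) λ a → Reach N ⟦ i ⟧ a × a ≗ ⟦ ps ⟧ × Star TxStep a m

    tx-run-reach : ∀ {a b} → Star TxStep a b → Reach N a b
    tx-run-reach = Star.map λ (t , _ , s) → t , s

    executing-reachable : ∀ {m} → Executing m → Reach N ⟦ i ⟧ m
    executing-reachable (_ , i→a , _ , a→m) = i→a ◅◅ tx-run-reach a→m

    executing-step : ∀ {a b} → Executing a → TxStep a b → Executing b
    executing-step (a₀ , i→a₀ , a₀≗ps , a₀→a) s = a₀ , i→a₀ , a₀≗ps , a₀→a ◅◅ (s ◅ ε)

    executing-start : ∀ {m} → Reach N ⟦ i ⟧ m → 1 ≤ m ps → Executing m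
    executing-start {m} i→m 1≤mps = m , i→m , boundary-exclusive ps-boundary m i→m 1≤mps , ε

    Region : Fin np → Set
    Region q = q ≡ ps ⊎ q ≡ pe ⊎ Inner q

    executing-support : ∀ {m} → Executing m → ∀ q → 1 ≤ m q → Region q
    executing-support (_ , _ , a≗ps , a→m) = run-support (λ q 1≤aq → inj₁ (singleton-support q a≗ps 1≤aq)) a→m
      where
      run-support : ∀ {a b} → (∀ q → 1 ≤ a q → Region q) → Star TxStep a b → ∀ q → 1 ≤ b q → Region q
      run-support a-in ε = a-in
      run-support {a} a-in ((t , t∈Tx , _ , b≗) ◅ b→c) = run-support b-in b→c
        where
        b-in : ∀ q → 1 ≤ _ → Region q
        b-in q 1≤bq with fire-marked {a} q (subst (1 ≤_) (b≗ q) 1≤bq)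
        ... | inj₁ 1≤aq = a-in q 1≤aq
        ... | inj₂ t→q  = inj₂ (Tx-output t∈Tx t→q)

    Idle : Marking N → Set
    Idle m = ∀ q → 1 ≤ m q → ¬ (q ≡ ps ⊎ Inner q)

    idle-disables-Tx : ∀ {m t} → Idle m → Enabled N m t → ¬ T (Tx t)
    idle-disables-Tx {t = t} idle (t∈T , marked) t∈Tx with has-input-place (proj₁ (transition-paths t t∈T))
    ... | q , q→t = idle q (marked q q→t) (Tx-input t∈Tx q→t)

    not-inner-beside-boundary : ∀ {a x q} → Boundary x → Reach N ⟦ i ⟧ a → 1 ≤ a x → 1 ≤ a q → ¬ Inner q
    not-inner-beside-boundary {a} {q = q} x-bnd i→a 1≤ax 1≤aq (q-int , _) =
      q-int (subst Boundary (sym (singleton-support q (boundary-exclusive x-bnd a i→a 1≤ax) 1≤aq)) x-bnd)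

    -- An inner token enables only Tx transitions, so while executing a non-Tx step fires from [ps] or [pe].
    non-Tx-step-avoids-inner : ∀ {a t} → Executing a ⊎ Idle a → Reach N ⟦ i ⟧ a → Enabled N a t → ¬ T (Tx t) →
                               ∀ q → 1 ≤ fire N a t q → ¬ Inner q
    non-Tx-step-avoids-inner {a} {t} phase i→a (t∈T , marked) t∉Tx q 1≤ with fire-marked {a} q 1≤
    ... | inj₂ t→q  = λ d → t∉Tx (inner-input-in-Tx d t→q)
    ... | inj₁ 1≤aq with phase
    ...   | inj₂ idle = λ d → idle q 1≤aq (inj₂ d)
    ...   | inj₁ executing with has-input-place (proj₁ (transition-paths t t∈T))
    ...     | q₀ , q₀→t with executing-support executing q₀ (marked q₀ q₀→t)
    ...       | inj₁ refl        = not-inner-beside-boundary ps-boundary i→a (marked q₀ q₀→t) 1≤aq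
    ...       | inj₂ (inj₁ refl) = not-inner-beside-boundary pe-boundary i→a (marked q₀ q₀→t) 1≤aq
    ...       | inj₂ (inj₂ d₀)   = ⊥-elim (t∉Tx (inner-output-in-Tx d₀ q₀→t))

    phase-without-inner : ∀ {b} → Reach N ⟦ i ⟧ b → (∀ q → 1 ≤ b q → ¬ Inner q) → Executing b ⊎ Idle b
    phase-without-inner {b} i→b no-inner with b ps in bps≡
    ... | suc _ = inj₁ (executing-start i→b (subst (1 ≤_) (sym bps≡) (s≤s z≤n)))
    ... | zero  = inj₂ λ q 1≤bq → [ (λ { refl → n≮0 (subst (1 ≤_) bps≡ 1≤bq) }) , no-inner q 1≤bq ]′

    phase-step : ∀ {a b} → Reach N ⟦ i ⟧ a → Executing a ⊎ Idle a → Step N a b → Executing b ⊎ Idle b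
    phase-step i→a phase s@(t , enabled , b≗) with T? (Tx t) | phase
    ... | yes t∈Tx | inj₁ executing = inj₁ (executing-step executing (t , t∈Tx , enabled , b≗))
    ... | yes t∈Tx | inj₂ idle      = ⊥-elim (idle-disables-Tx idle enabled t∈Tx)
    ... | no t∉Tx  | _              =
      phase-without-inner (i→a ◅◅ (s ◅ ε)) λ q 1≤bq →
        non-Tx-step-avoids-inner phase i→a enabled t∉Tx q (subst (1 ≤_) (b≗ q) 1≤bq)

    phase : ∀ {m} → Reach N ⟦ i ⟧ m → Executing m ⊎ Idle m
    phase = go ε (inj₂ idle-initially)
      where
      idle-initially : Idle ⟦ i ⟧
      idle-initially q 1≤ with singleton-support q (λ _ → refl) 1≤
      ... | refl = [ boundary≢i ps-boundary ∘ sym , (λ d → inner≢i d refl) ]′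

      go : ∀ {a b} → Reach N ⟦ i ⟧ a → Executing a ⊎ Idle a → Reach N a b → Executing b ⊎ Idle b
      go i→a phase-a ε         = phase-a
      go i→a phase-a (s ◅ a→b) = go (i→a ◅◅ (s ◅ ε)) (phase-step i→a phase-a s) a→b

    Tx-enabled-while-executing : ∀ {t} → T (Tx t) → ∃ λ m → Executing m × Enabled N m t
    Tx-enabled-while-executing {t} t∈Tx with live t (Forward.Ts-transition t∈Tx)
    ... | m , i→m , enabled with phase i→m
    ...   | inj₁ executing = m , executing , enabled
    ...   | inj₂ idle      = ⊥-elim (idle-disables-Tx idle enabled t∈Tx)

    -- Once ps is empty, every step of a run to [o] consumes an inner token (ps and pe being empty),
    -- so it is a Tx step and keeps ps empty; the run must hit pe before it could reach o.
    finish-execution : ∀ {m c} → Executing m → m ps ≡ 0 → Reach N m c → c ≗ ⟦ o ⟧ →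
                       ∃ λ c′ → Star TxStep m c′ × c′ ≗ ⟦ pe ⟧
    finish-execution {m} executing mps≡0 m→c c≗o with m pe in mpe≡
    ... | suc _ = m , ε , boundary-exclusive pe-boundary m (executing-reachable executing)
                                           (subst (1 ≤_) (sym mpe≡) (s≤s z≤n))
    finish-execution {m} executing mps≡0 ε c≗o | zero
      with executing-support executing o (subst (1 ≤_) (sym (trans (c≗o o) (singleton-self o))) (s≤s z≤n))
    ... | inj₁ o≡ps        = ⊥-elim (boundary≢o ps-boundary (sym o≡ps))
    ... | inj₂ (inj₁ o≡pe) = ⊥-elim (boundary≢o pe-boundary (sym o≡pe))
    ... | inj₂ (inj₂ d)    = ⊥-elim (inner≢o d refl)
    finish-execution {m} executing mps≡0 (_◅_ {j = b} (t , enabled@(t∈T , marked) , b≗) b→c) c≗o | zero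
      with has-input-place (proj₁ (transition-paths t t∈T))
    ... | q , q→t with executing-support executing q (marked q q→t)
    ...   | inj₁ refl        = ⊥-elim (n≮0 (subst (1 ≤_) mps≡0 (marked q q→t)))
    ...   | inj₂ (inj₁ refl) = ⊥-elim (n≮0 (subst (1 ≤_) mpe≡ (marked q q→t)))
    ...   | inj₂ (inj₂ d)    =
      let (c′ , b→c′ , c′≗pe) = finish-execution (executing-step executing tx-step) bps≡0 b→c c≗o
      in c′ , tx-step ◅ b→c′ , c′≗pe
      where
      t∈Tx : T (Tx t)
      t∈Tx = inner-output-in-Tx d q→t
      tx-step : TxStep m b
      tx-step = t , t∈Tx , enabled , b≗
      bps≡0 : b ps ≡ 0
      bps≡0 = trans (b≗ ps) (fire-unmarked {m} ps mps≡0 (λ t→ps → ps-no-Tx-input t t→ps t∈Tx))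

    execution-completes : ∀ {m} → Executing m → ∃ λ c → Star TxStep m c × c ≗ ⟦ pe ⟧
    execution-completes {m} executing with m ps in mps≡
    ... | zero  = let (c , m→c , c≗o) = completable m (executing-reachable executing)
                  in finish-execution executing mps≡ m→c c≗o
    -- From [ps] a completing run may leave through a non-Tx transition (tsink when ps = predo),
    -- so a Tx transition out of ps is fired first.
    ... | suc _ with Forward.first-transition
    ...   | t , t∈Tx , ps→t with Tx-enabled-while-executing t∈Tx
    ...     | m₁ , executing₁ , enabled₁ =
      let (c , b→c , c≗o) = completable (fire N m t) (executing-reachable executing′)
          (c′ , b→c′ , c′≗pe) = finish-execution executing′ bps≡0 b→c c≗o
      in c′ , tx-step ◅ b→c′ , c′≗pe
      where
      m≗ps : m ≗ ⟦ ps ⟧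
      m≗ps = boundary-exclusive ps-boundary m (executing-reachable executing) (subst (1 ≤_) (sym mps≡) (s≤s z≤n))
      m₁≗ps : m₁ ≗ ⟦ ps ⟧
      m₁≗ps = boundary-exclusive ps-boundary m₁ (executing-reachable executing₁) (proj₂ enabled₁ ps ps→t)
      tx-step : TxStep m (fire N m t)
      tx-step = t , t∈Tx , enabled-resp (λ p → trans (m≗ps p) (sym (m₁≗ps p))) enabled₁ , λ _ → refl
      executing′ : Executing (fire N m t)
      executing′ = executing-step executing tx-step
      bps≡0 : fire N m t ps ≡ 0
      bps≡0 = fire-consumes {m} ps (trans (m≗ps ps) (singleton-self ps)) ps→t
                            (λ t→ps → ps-no-Tx-input t t→ps t∈Tx)

    N′ : Net A np nt
    N′ = loopproject N i o ps pe Tx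

    i-interior : ¬ Boundary i
    i-interior i-bnd = boundary≢i i-bnd refl

    o-interior : ¬ Boundary o
    o-interior o-bnd = boundary≢o o-bnd refl

    interior-if-≢ : ∀ {p} → p ≢ ps → p ≢ pe → ¬ Boundary p
    interior-if-≢ p≢ps p≢pe p-bnd = [ p≢ps , p≢pe ]′ (cover _ p-bnd)

    place′⇔ : ∀ {p} → T (place N′ p) ⇔ (p ≡ i ⊎ p ≡ o ⊎ Inner p)
    place′⇔ {p} = mk⇔ place′→ place′←
      where
      touches fresh : Bool
      touches = anyFin λ t → Tx t ∧ (post N t p ∨ pre N p t)
      fresh   = not (p == ps) ∧ not (p == pe)

      place′→ : T (place N′ p) → p ≡ i ⊎ p ≡ o ⊎ Inner p
      place′→ h with to (T-∨ {(place N p ∧ touches) ∧ fresh}) h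
      ... | inj₂ at-io = [ inj₁ ∘ toWitness , inj₂ ∘ inj₁ ∘ toWitness ]′ (to (T-∨ {p == i}) at-io)
      ... | inj₁ h₁ with to (T-∧ {place N p ∧ touches}) h₁
      ...   | p∈P∧touches , p-fresh with to (T-∧ {place N p}) p∈P∧touches | to (T-∧ {not (p == ps)}) p-fresh
      ...     | _ , touching | p≢ps , p≢pe with to T-anyFin touching
      ...       | u , hu with to (T-∧ {Tx u}) hu
      ...         | u∈Tx , adjacent =
        inj₂ (inj₂ (interior-if-≢ (to T-not-== p≢ps) (to T-not-== p≢pe) ,
                    u , u∈Tx , swap (to (T-∨ {post N u p}) adjacent)))

      place′← : p ≡ i ⊎ p ≡ o ⊎ Inner p → T (place N′ p)
      place′← (inj₁ refl) =
        from (T-∨ {(place N p ∧ touches) ∧ fresh}) (inj₂ (from (T-∨ {p == i}) (inj₁ (fromWitness refl))))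
      place′← (inj₂ (inj₁ refl)) =
        from (T-∨ {(place N p ∧ touches) ∧ fresh}) (inj₂ (from (T-∨ {p == i}) (inj₂ (fromWitness refl))))
      place′← (inj₂ (inj₂ d@(p-int , u , u∈Tx , adjacent))) =
        from (T-∨ {(place N p ∧ touches) ∧ fresh}) (inj₁ (from (T-∧ {place N p ∧ touches})
          (from (T-∧ {place N p})
             (inner-place d , from T-anyFin (u , from (T-∧ {Tx u}) (u∈Tx , from (T-∨ {post N u p}) (swap adjacent)))) ,
           from (T-∧ {not (p == ps)}) (from T-not-== (λ { refl → p-int ps-boundary }) ,
                                       from T-not-== (λ { refl → p-int pe-boundary })))))

    -- rename sends a place of N′ to the place of N it stands for (i ↦ ps, o ↦ pe); lift goes back.
    rename : Fin np → Fin np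
    rename p with p ≟ i | p ≟ o
    ... | yes _ | _     = ps
    ... | no _  | yes _ = pe
    ... | no _  | no _  = p

    i-o-or-other : ∀ p → p ≡ i ⊎ p ≡ o ⊎ (p ≢ i × p ≢ o)
    i-o-or-other p with p ≟ i | p ≟ o
    ... | yes p≡i | _       = inj₁ p≡i
    ... | no _    | yes p≡o = inj₂ (inj₁ p≡o)
    ... | no p≢i  | no p≢o  = inj₂ (inj₂ (p≢i , p≢o))

    rename-i : rename i ≡ ps
    rename-i with i ≟ i
    ... | yes _  = refl
    ... | no i≢i = ⊥-elim (i≢i refl)

    rename-o : rename o ≡ pe
    rename-o with o ≟ i | o ≟ o
    ... | yes o≡i | _     = ⊥-elim (i≢o (sym o≡i))
    ... | no _    | yes _ = refl
    ... | no _    | no o≢o = ⊥-elim (o≢o refl)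

    rename-other : ∀ {p} → p ≢ i → p ≢ o → rename p ≡ p
    rename-other {p} p≢i p≢o with p ≟ i | p ≟ o
    ... | yes p≡i | _       = ⊥-elim (p≢i p≡i)
    ... | no _    | yes p≡o = ⊥-elim (p≢o p≡o)
    ... | no _    | no _    = refl

    lift : Fin np → Fin np
    lift q with q ≟ ps | q ≟ pe
    ... | yes _ | _     = i
    ... | no _  | yes _ = o
    ... | no _  | no _  = q

    lift-ps : lift ps ≡ i
    lift-ps with ps ≟ ps
    ... | yes _    = refl
    ... | no ps≢ps = ⊥-elim (ps≢ps refl)

    lift-pe : lift pe ≡ o
    lift-pe with pe ≟ ps | pe ≟ pe
    ... | yes pe≡ps | _      = ⊥-elim (ps≢pe (sym pe≡ps))
    ... | no _      | yes _  = refl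
    ... | no _      | no pe≢pe = ⊥-elim (pe≢pe refl)

    lift-interior : ∀ {q} → ¬ Boundary q → lift q ≡ q
    lift-interior {q} q-int with q ≟ ps | q ≟ pe
    ... | yes refl | _        = ⊥-elim (q-int ps-boundary)
    ... | no _     | yes refl = ⊥-elim (q-int pe-boundary)
    ... | no _     | no _     = refl

    pre′⇔ : ∀ {p t} → T (pre N′ p t) ⇔ (T (Tx t) × ¬ Boundary p × T (pre N (rename p) t))
    pre′⇔ {p} {t} = mk⇔ pre′→ pre′←
      where
      pre′→ : T (pre N′ p t) → T (Tx t) × ¬ Boundary p × T (pre N (rename p) t)
      pre′→ h with to (T-∨ {pre N p t ∧ place N′ p ∧ Tx t}) h
      ... | inj₂ h₂ with to (T-∧ {p == i}) h₂
      ...   | p==i , h₃ with toWitness p==i | to (T-∧ {Tx t}) h₃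
      ...     | refl | t∈Tx , ps→t = t∈Tx , i-interior , subst (λ x → T (pre N x t)) (sym rename-i) ps→t
      pre′→ h | inj₁ h₁ with to (T-∧ {pre N p t}) h₁
      ... | p→t , h₂ with to (T-∧ {place N′ p}) h₂
      ...   | p∈P′ , t∈Tx with to place′⇔ p∈P′
      ...     | inj₁ refl        = ⊥-elim (source∉Tx (subst (T ∘ Tx) (to (i-outputs t) p→t) t∈Tx))
      ...     | inj₂ (inj₁ refl) = ⊥-elim (o-no-output t p→t)
      ...     | inj₂ (inj₂ d)    =
        t∈Tx , proj₁ d , subst (λ x → T (pre N x t)) (sym (rename-other (inner≢i d) (inner≢o d))) p→t

      pre′← : T (Tx t) × ¬ Boundary p × T (pre N (rename p) t) → T (pre N′ p t)
      pre′← (t∈Tx , p-int , rp→t) with i-o-or-other p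
      ... | inj₁ refl =
        from (T-∨ {pre N p t ∧ place N′ p ∧ Tx t})
             (inj₂ (from (T-∧ {p == i})
               (fromWitness refl , from (T-∧ {Tx t}) (t∈Tx , subst (λ x → T (pre N x t)) rename-i rp→t))))
      ... | inj₂ (inj₁ refl) = ⊥-elim (pe-no-Tx-output t (subst (λ x → T (pre N x t)) rename-o rp→t) t∈Tx)
      ... | inj₂ (inj₂ (p≢i , p≢o)) =
        from (T-∨ {pre N p t ∧ place N′ p ∧ Tx t})
             (inj₁ (from (T-∧ {pre N p t})
               (p→t , from (T-∧ {place N′ p}) (from place′⇔ (inj₂ (inj₂ (p-int , t , t∈Tx , inj₁ p→t))) , t∈Tx))))
        where
        p→t : T (pre N p t)
        p→t = subst (λ x → T (pre N x t)) (rename-other p≢i p≢o) rp→t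

    post′⇔ : ∀ {p t} → T (post N′ t p) ⇔ (T (Tx t) × ¬ Boundary p × T (post N t (rename p)))
    post′⇔ {p} {t} = mk⇔ post′→ post′←
      where
      post′→ : T (post N′ t p) → T (Tx t) × ¬ Boundary p × T (post N t (rename p))
      post′→ h with to (T-∨ {post N t p ∧ place N′ p ∧ Tx t}) h
      ... | inj₂ h₂ with to (T-∧ {p == o}) h₂
      ...   | p==o , h₃ with toWitness p==o | to (T-∧ {Tx t}) h₃
      ...     | refl | t∈Tx , t→pe = t∈Tx , o-interior , subst (T ∘ post N t) (sym rename-o) t→pe
      post′→ h | inj₁ h₁ with to (T-∧ {post N t p}) h₁
      ... | t→p , h₂ with to (T-∧ {place N′ p}) h₂
      ...   | p∈P′ , t∈Tx with to place′⇔ p∈P′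
      ...     | inj₁ refl        = ⊥-elim (i-no-input t t→p)
      ...     | inj₂ (inj₁ refl) = ⊥-elim (sink∉Tx (subst (T ∘ Tx) (to (o-inputs t) t→p) t∈Tx))
      ...     | inj₂ (inj₂ d)    =
        t∈Tx , proj₁ d , subst (T ∘ post N t) (sym (rename-other (inner≢i d) (inner≢o d))) t→p

      post′← : T (Tx t) × ¬ Boundary p × T (post N t (rename p)) → T (post N′ t p)
      post′← (t∈Tx , p-int , t→rp) with i-o-or-other p
      ... | inj₁ refl = ⊥-elim (ps-no-Tx-input t (subst (T ∘ post N t) rename-i t→rp) t∈Tx)
      ... | inj₂ (inj₁ refl) =
        from (T-∨ {post N t p ∧ place N′ p ∧ Tx t})
             (inj₂ (from (T-∧ {p == o})
               (fromWitness refl , from (T-∧ {Tx t}) (t∈Tx , subst (T ∘ post N t) rename-o t→rp))))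
      ... | inj₂ (inj₂ (p≢i , p≢o)) =
        from (T-∨ {post N t p ∧ place N′ p ∧ Tx t})
             (inj₁ (from (T-∧ {post N t p})
               (t→p , from (T-∧ {place N′ p}) (from place′⇔ (inj₂ (inj₂ (p-int , t , t∈Tx , inj₂ t→p))) , t∈Tx))))
        where
        t→p : T (post N t p)
        t→p = subst (T ∘ post N t) (rename-other p≢i p≢o) t→rp

    lift-region : ∀ {q} → Region q → ¬ Boundary (lift q) × rename (lift q) ≡ q
    lift-region (inj₁ refl) =
      subst (¬_ ∘ Boundary) (sym lift-ps) i-interior , trans (cong rename lift-ps) rename-i
    lift-region (inj₂ (inj₁ refl)) =
      subst (¬_ ∘ Boundary) (sym lift-pe) o-interior , trans (cong rename lift-pe) rename-o
    lift-region (inj₂ (inj₂ d@(q-int , _))) =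
      subst (¬_ ∘ Boundary) (sym (lift-interior q-int)) q-int ,
      trans (cong rename (lift-interior q-int)) (rename-other (inner≢i d) (inner≢o d))

    lift-rename : ∀ {p} → ¬ Boundary p → lift (rename p) ≡ p
    lift-rename {p} p-int with i-o-or-other p
    ... | inj₁ refl               = trans (cong lift rename-i) lift-ps
    ... | inj₂ (inj₁ refl)        = trans (cong lift rename-o) lift-pe
    ... | inj₂ (inj₂ (p≢i , p≢o)) = trans (cong lift (rename-other p≢i p≢o)) (lift-interior p-int)

    lift-input : ∀ {q t} → T (Tx t) → T (pre N q t) → T (pre N′ (lift q) t)
    lift-input {t = t} t∈Tx q→t =
      let (lq-int , rename-lq) = lift-region ([ inj₁ , inj₂ ∘ inj₂ ]′ (Tx-input t∈Tx q→t))
      in from pre′⇔ (t∈Tx , lq-int , subst (λ x → T (pre N x t)) (sym rename-lq) q→t)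

    lift-output : ∀ {q t} → T (Tx t) → T (post N t q) → T (post N′ t (lift q))
    lift-output {t = t} t∈Tx t→q =
      let (lq-int , rename-lq) = lift-region (inj₂ (Tx-output t∈Tx t→q))
      in from post′⇔ (t∈Tx , lq-int , subst (T ∘ post N t) (sym rename-lq) t→q)

    ψ : Marking N → Marking N′
    ψ m p with boundary? p
    ... | yes _ = 0
    ... | no _  = m (rename p)

    ψ-boundary : ∀ {m p} → Boundary p → ψ m p ≡ 0
    ψ-boundary {p = p} p-bnd with boundary? p
    ... | yes _    = refl
    ... | no p-int = ⊥-elim (p-int p-bnd)

    ψ-interior : ∀ {m p} → ¬ Boundary p → ψ m p ≡ m (rename p)
    ψ-interior {p = p} p-int with boundary? p
    ... | yes p-bnd = ⊥-elim (p-int p-bnd)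
    ... | no _      = refl

    ψ-resp : ∀ {a b} → a ≗ b → ψ a ≗ ψ b
    ψ-resp a≗b p with boundary? p
    ... | yes _ = refl
    ... | no _  = a≗b (rename p)

    ψ-safe : ∀ {m} → (∀ p → m p ≤ 1) → ∀ p → ψ m p ≤ 1
    ψ-safe m≤1 p with boundary? p
    ... | yes _ = z≤n
    ... | no _  = m≤1 (rename p)

    ψ-singleton : ∀ {x} → Region x → ψ ⟦ x ⟧ ≗ ⟦ lift x ⟧
    ψ-singleton {x} x-reg p with boundary-or-interior p
    ... | inj₁ p-bnd = trans (ψ-boundary p-bnd) (sym (singleton-other λ { refl → proj₁ (lift-region x-reg) p-bnd }))
    ... | inj₂ p-int = trans (ψ-interior p-int) (singleton-≡ (mk⇔ renamed→ renamed←))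
      where
      renamed→ : rename p ≡ x → p ≡ lift x
      renamed→ rename-p≡x = trans (sym (lift-rename p-int)) (cong lift rename-p≡x)
      renamed← : p ≡ lift x → rename p ≡ x
      renamed← refl = proj₂ (lift-region x-reg)

    ψ-ps : ψ ⟦ ps ⟧ ≗ ⟦ i ⟧
    ψ-ps p = trans (ψ-singleton (inj₁ refl) p) (cong (λ x → ⟦ x ⟧ p) lift-ps)

    ψ-pe : ψ ⟦ pe ⟧ ≗ ⟦ o ⟧
    ψ-pe p = trans (ψ-singleton (inj₂ (inj₁ refl)) p) (cong (λ x → ⟦ x ⟧ p) lift-pe)

    module Firing′ = Firing N′

    fire-ψ : ∀ {m t} → T (Tx t) → ψ (fire N m t) ≗ fire N′ (ψ m) t
    fire-ψ {m} {t} t∈Tx p with boundary-or-interior p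
    ... | inj₁ p-bnd =
      trans (ψ-boundary p-bnd) (sym (Firing′.fire-unmarked {ψ m} p (ψ-boundary p-bnd) (λ t→p → proj₁ (proj₂ (to post′⇔ t→p)) p-bnd)))
    ... | inj₂ p-int =
      trans (ψ-interior p-int) (fire-cong N N′ {m} {ψ m} (sym (ψ-interior p-int)) pre⇔ post⇔)
      where
      pre⇔ : T (pre N (rename p) t) ⇔ T (pre N′ p t)
      pre⇔ = mk⇔ (λ h → from pre′⇔ (t∈Tx , p-int , h)) (λ h → proj₂ (proj₂ (to pre′⇔ h)))
      post⇔ : T (post N t (rename p)) ⇔ T (post N′ t p)
      post⇔ = mk⇔ (λ h → from post′⇔ (t∈Tx , p-int , h)) (λ h → proj₂ (proj₂ (to post′⇔ h)))

    enabled-ψ : ∀ {m t} → T (Tx t) → Enabled N m t → Enabled N′ (ψ m) t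
    enabled-ψ t∈Tx (_ , marked) = t∈Tx , λ p p→t →
      let (_ , p-int , rp→t) = to pre′⇔ p→t in subst (1 ≤_) (sym (ψ-interior p-int)) (marked (rename p) rp→t)

    enabled-ψ⁻ : ∀ {m t} → Enabled N′ (ψ m) t → Enabled N m t
    enabled-ψ⁻ {m} {t} (t∈Tx , marked′) = Forward.Ts-transition t∈Tx , marked
      where
      marked : ∀ q → T (pre N q t) → 1 ≤ m q
      marked q q→t with lift-region ([ inj₁ , inj₂ ∘ inj₂ ]′ (Tx-input t∈Tx q→t))
      ... | lq-int , rename-lq =
        subst (1 ≤_) (trans (ψ-interior lq-int) (cong m rename-lq)) (marked′ (lift q) (lift-input t∈Tx q→t))

    tx-step-ψ : ∀ {a b} → TxStep a b → Step N′ (ψ a) (ψ b)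
    tx-step-ψ (t , t∈Tx , enabled , b≗) = t , enabled-ψ t∈Tx enabled , λ p → trans (ψ-resp b≗ p) (fire-ψ t∈Tx p)

    tx-run-ψ : ∀ {a b} → Star TxStep a b → Reach N′ (ψ a) (ψ b)
    tx-run-ψ = gmap ψ tx-step-ψ

    executing-ψ : ∀ {m} → Executing m → Firing′._⇝_ ⟦ i ⟧ (ψ m)
    executing-ψ (a , _ , a≗ps , a→m) = Firing′.reach-resp (λ p → sym (trans (ψ-resp a≗ps p) (ψ-ps p))) (tx-run-ψ a→m)

    step′-ψ : ∀ {a a′ b′} → Executing a → a′ ≗ ψ a → Step N′ a′ b′ → ∃ λ b → Executing b × b′ ≗ ψ b
    step′-ψ {a} executing a′≗ψa (t , enabled′ , b′≗) =
      fire N a t , executing-step executing tx-step ,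
      λ p → trans (b′≗ p) (trans (Firing′.fire-resp t a′≗ψa p) (sym (fire-ψ (proj₁ enabled′) p)))
      where
      tx-step : TxStep a (fire N a t)
      tx-step = t , proj₁ enabled′ , enabled-ψ⁻ (Firing′.enabled-resp (λ p → sym (a′≗ψa p)) enabled′) , λ _ → refl

    reachable′-ψ : ∀ {m′} → Reach N′ ⟦ i ⟧ m′ → ∃ λ m → Executing m × m′ ≗ ψ m
    reachable′-ψ = go start
      where
      start : ∃ λ a → Executing a × ⟦ i ⟧ ≗ ψ a
      start with boundary-reachable ps-boundary
      ... | a , i→a , a≗ps = a , (a , i→a , a≗ps , ε) , λ p → sym (trans (ψ-resp a≗ps p) (ψ-ps p))

      go : ∀ {a′ m′} → (∃ λ a → Executing a × a′ ≗ ψ a) → Reach N′ a′ m′ → ∃ λ m → Executing m × m′ ≗ ψ m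
      go related ε = related
      go (a , executing , a′≗ψa) (s ◅ b′→m′) = go (step′-ψ executing a′≗ψa s) b′→m′

    lift-walk : ∀ {Bad a b ts} → AvoidingWalk Bad a b ts → (∀ {t} → t ∈ ts → T (Tx t)) →
                Path N′ (pl (lift a)) (pl (lift b))
    lift-walk done _ = ε
    lift-walk (hop _ (_ , a→t , t→c) w) in-Tx =
      pt (lift-input (in-Tx (here refl)) a→t) ◅ tp (lift-output (in-Tx (here refl)) t→c) ◅ lift-walk w (in-Tx ∘ there)

    lift-walk-through : ∀ {Bad a b ts t} → AvoidingWalk Bad a b ts → (∀ {u} → u ∈ ts → T (Tx u)) → t ∈ ts →
                        Path N′ (pl (lift a)) (tr t) × Path N′ (tr t) (pl (lift b))
    lift-walk-through (hop _ (_ , a→t , t→c) w) in-Tx (here refl) =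
      pt (lift-input (in-Tx (here refl)) a→t) ◅ ε ,
      tp (lift-output (in-Tx (here refl)) t→c) ◅ lift-walk w (in-Tx ∘ there)
    lift-walk-through (hop _ (_ , a→u , u→c) w) in-Tx (there t∈) =
      let (into , out) = lift-walk-through w (in-Tx ∘ there) t∈
      in pt (lift-input (in-Tx (here refl)) a→u) ◅ tp (lift-output (in-Tx (here refl)) u→c) ◅ into , out

    -- A PTR walk through t runs from ps to pe using only Tx transitions; lifted, it runs from i to o.
    Tx-paths′ : ∀ {t} → T (Tx t) → Path N′ (pl i) (tr t) × Path N′ (tr t) (pl o)
    Tx-paths′ {t} t∈Tx with to (Tx-PTR t) t∈Tx
    ... | ts , w , t∈ with lift-walk-through (avoiding-from-walk w) (λ u∈ → from (Tx-PTR _) (ts , w , u∈)) t∈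
    ...   | into , out = subst (λ x → Path N′ (pl x) (tr t)) lift-ps into ,
                         subst (λ x → Path N′ (tr t) (pl x)) lift-pe out

    i→o′ : Path N′ (pl i) (pl o)
    i→o′ = let (into , out) = Tx-paths′ (proj₂ Tx-nonempty) in into ◅◅ out

    inner-paths′ : ∀ {p} → Inner p → Path N′ (pl i) (pl p) × Path N′ (pl p) (pl o)
    inner-paths′ {p} d with has-input-transition (proj₁ (place-paths p (inner-place d))) (inner≢i d ∘ sym)
                          | has-output-transition (proj₂ (place-paths p (inner-place d))) (inner≢o d)
    ... | v , v→p | u , p→u =
      proj₁ (Tx-paths′ v∈Tx) ◅◅ (tp v→′p ◅ ε) , pt p→′u ◅ proj₂ (Tx-paths′ u∈Tx)
      where
      v∈Tx : T (Tx v)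
      v∈Tx = inner-input-in-Tx d v→p
      u∈Tx : T (Tx u)
      u∈Tx = inner-output-in-Tx d p→u
      v→′p : T (post N′ v p)
      v→′p = subst (T ∘ post N′ v) (lift-interior (proj₁ d)) (lift-output v∈Tx v→p)
      p→′u : T (pre N′ p u)
      p→′u = subst (λ x → T (pre N′ x u)) (lift-interior (proj₁ d)) (lift-input u∈Tx p→u)

    place-paths′ : ∀ p → T (place N′ p) → Path N′ (pl i) (pl p) × Path N′ (pl p) (pl o)
    place-paths′ p p∈P′ with to place′⇔ p∈P′
    ... | inj₁ refl        = ε , i→o′
    ... | inj₂ (inj₁ refl) = i→o′ , ε
    ... | inj₂ (inj₂ d)    = inner-paths′ d

    renamed-place : ∀ {p t} → T (Tx t) → ¬ Boundary p →
                    T (pre N (rename p) t) ⊎ T (post N t (rename p)) → T (place N′ p)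
    renamed-place {p} t∈Tx p-int adjacent with i-o-or-other p
    ... | inj₁ refl               = from place′⇔ (inj₁ refl)
    ... | inj₂ (inj₁ refl)        = from place′⇔ (inj₂ (inj₁ refl))
    ... | inj₂ (inj₂ (p≢i , p≢o)) =
      from place′⇔ (inj₂ (inj₂ (p-int , _ , t∈Tx ,
                                subst (λ x → T (pre N x _) ⊎ T (post N _ x)) (rename-other p≢i p≢o) adjacent)))

    module Paths′ = Paths N′

    wf′ : IsWFNet N′ i o
    wf′ = (flow-pre′ , flow-post′) ,
          (from place′⇔ (inj₁ refl) , i-no-input′ , Paths′.source-unique (λ p p∈P′ → proj₁ (place-paths′ p p∈P′))) ,
          (from place′⇔ (inj₂ (inj₁ refl)) , o-no-output′ , Paths′.sink-unique (λ p p∈P′ → proj₂ (place-paths′ p p∈P′))) ,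
          place-paths′ , λ t → Tx-paths′
      where
      flow-pre′ : ∀ p t → T (pre N′ p t) → T (place N′ p) × T (Tx t)
      flow-pre′ p t p→t = let (t∈Tx , p-int , rp→t) = to pre′⇔ p→t in renamed-place t∈Tx p-int (inj₁ rp→t) , t∈Tx

      flow-post′ : ∀ t p → T (post N′ t p) → T (Tx t) × T (place N′ p)
      flow-post′ t p t→p = let (t∈Tx , p-int , t→rp) = to post′⇔ t→p in t∈Tx , renamed-place t∈Tx p-int (inj₂ t→rp)

      i-no-input′ : ∀ t → ¬ T (post N′ t i)
      i-no-input′ t t→i =
        let (t∈Tx , _ , t→ri) = to post′⇔ t→i in ps-no-Tx-input t (subst (T ∘ post N t) rename-i t→ri) t∈Tx

      o-no-output′ : ∀ t → ¬ T (pre N′ o t)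
      o-no-output′ t o→t =
        let (t∈Tx , _ , ro→t) = to pre′⇔ o→t in pe-no-Tx-output t (subst (λ x → T (pre N x t)) rename-o ro→t) t∈Tx

    safe′ : Safe N′ i
    safe′ m′ i→m′ p with reachable′-ψ i→m′
    ... | m , executing , m′≗ψm = subst (_≤ 1) (sym (m′≗ψm p)) (ψ-safe (safe m (executing-reachable executing)) p)

    live′ : ∀ t → T (Tx t) → Σ (Marking N′) λ m′ → Reach N′ ⟦ i ⟧ m′ × Enabled N′ m′ t
    live′ t t∈Tx with Tx-enabled-while-executing t∈Tx
    ... | m , executing , enabled with executing-ψ executing
    ...   | m′ , i→m′ , m′≗ψm = m′ , i→m′ , Firing′.enabled-resp m′≗ψm (enabled-ψ t∈Tx enabled)

    completable′ : ∀ m′ → Reach N′ ⟦ i ⟧ m′ → Σ (Marking N′) λ c′ → Reach N′ m′ c′ × c′ ≗ ⟦ o ⟧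
    completable′ m′ i→m′ with reachable′-ψ i→m′
    ... | m , executing , m′≗ψm with execution-completes executing
    ...   | c , m→c , c≗pe with Firing′.reach-resp m′≗ψm (tx-run-ψ m→c)
    ...     | c′ , m′→c′ , c′≗ψc = c′ , m′→c′ , λ p → trans (c′≗ψc p) (trans (ψ-resp c≗pe p) (ψ-pe p))

    proper′ : ∀ m′ → Reach N′ ⟦ i ⟧ m′ → 1 ≤ m′ o → m′ ≗ ⟦ o ⟧
    proper′ m′ i→m′ 1≤m′o with reachable′-ψ i→m′
    ... | m , executing , m′≗ψm = λ p → trans (m′≗ψm p) (trans (ψ-resp m≗pe p) (ψ-pe p))
      where
      m≗pe : m ≗ ⟦ pe ⟧
      m≗pe = boundary-exclusive pe-boundary m (executing-reachable executing)
               (subst (1 ≤_) (trans (m′≗ψm o) (trans (ψ-interior o-interior) (cong m rename-o))) 1≤m′o)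

    projection-safe-sound : SafeSoundWF N′ i o
    projection-safe-sound = wf′ , safe′ , live′ , completable′ , proper′

lemma2 : {A : Set} {np nt : ℕ} (N : Net A np nt) (i o : Fin np)
         (Tdo Tredo Tτ : Fin nt → Bool) (pdo predo : Fin np) →
         SafeSoundWF N i o →
         IsLoopPattern N i o Tdo Tredo Tτ pdo predo →
         SafeSoundWF (loopproject N i o pdo predo Tdo) i o ×
         SafeSoundWF (loopproject N i o predo pdo Tredo) i o
lemma2 N i o Tdo Tredo Tτ pdo predo
  (((flow-pre , flow-post) , (_ , i-no-input , _) , (_ , o-no-output , _) , place-paths , transition-paths) ,
   safe , live , completable , proper)
  (_ , (_ , Tdo∩Tredo , Tdo∩Tτ , Tredo∩Tτ , Tdo-nonempty , Tredo-nonempty , _) , _ , _ ,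
   tsource , tsink , Tτ-sides , source≢sink , _ , _ ,
   i-outputs , o-inputs , source-inputs , source-outputs , sink-inputs , sink-outputs ,
   Tdo-PTR , Tredo-PTR , pdo-no-Tdo-input , predo-no-Tredo-input , predo-no-Tdo-output , pdo-no-Tredo-output) =
  Do.projection-safe-sound , Redo.projection-safe-sound
  where
  open Loop N flow-pre flow-post i-no-input o-no-output place-paths transition-paths safe live completable proper
            i-outputs o-inputs source-inputs source-outputs sink-inputs sink-outputs source≢sink

  source∈Tτ : T (Tτ tsource)
  source∈Tτ = from (Tτ-sides tsource) (inj₁ refl)

  sink∈Tτ : T (Tτ tsink)
  sink∈Tτ = from (Tτ-sides tsink) (inj₂ refl)

  module Do = Side (inj₁ refl) (inj₂ refl) (λ _ x-bnd → x-bnd) Tdo-PTR Tredo-PTR Tdo-nonempty Tredo-nonempty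
                   Tdo∩Tredo pdo-no-Tdo-input predo-no-Tdo-output
                   (λ source∈Tdo → Tdo∩Tτ tsource source∈Tdo source∈Tτ)
                   (λ sink∈Tdo → Tdo∩Tτ tsink sink∈Tdo sink∈Tτ)

  module Redo = Side (inj₂ refl) (inj₁ refl) (λ _ x-bnd → swap x-bnd) Tredo-PTR Tdo-PTR Tredo-nonempty Tdo-nonempty
                     (λ t t∈Tredo t∈Tdo → Tdo∩Tredo t t∈Tdo t∈Tredo) predo-no-Tredo-input pdo-no-Tredo-output
                     (λ source∈Tredo → Tredo∩Tτ tsource source∈Tredo source∈Tτ)
                     (λ sink∈Tredo → Tredo∩Tτ tsink sink∈Tredo sink∈Tτ)
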